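{- Let $H$ be a finite abelian group with a fixed enumeration $H = \{h_0 = 0_H, h_1, \dots, h_{t-1}\}$, and let $\bm{\lambda} = (\lambda_0,\dots,\lambda_{t-1})$ be a sequence of nonnegative integers. Suppose that every non-zero sum subset of $(\mathbb{Z}\times H)\setminus\{0_{\mathbb{Z}\times H}\}$ of type $\bm{\lambda}$ is sequenceable. Then for every $n \geq 2$, every non-zero sum subset of $(\mathbb{Z}^n \times H)\setminus\{0_{\mathbb{Z}^n\times H}\}$ of type $\bm{\lambda}$ is sequenceable.
   Context: Let $A$ be an abelian group and $S \subseteq A\setminus\{0\}$ a finite subset of size $k$. For an ordering $(x_1,\dots,x_k)$ of $S$, its partial sums are $y_0 = 0$ and $y_i = x_1+\dots+x_i$. $S$ is sequenceable if some ordering has partial sums $y_0,\dots,y_k$ pairwise distinct, except that $y_k = y_0 = 0$ is permitted. $S$ is non-zero sum if $\sum_{s\in S} s \neq 0$. For a group of the form $X \times H$ with $H$ enumerated as $\{h_0=0_H,h_1,\dots,h_{t-1}\}$, the type of a finite subset $S$ is $\bm{\lambda}=(\lambda_0,\dots,\lambda_{t-1})$ where $\lambda_i$ is the number of elements $s\in S$ whose projection to $H$ equals $h_i$. -}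

module Defs where

open import Level using (Level; _⊔_)
open import Data.Nat using (ℕ; zero; suc)
open import Data.Fin using (Fin; toℕ)
open import Data.Integer as ℤ using (ℤ)
open import Data.Product using (_×_; _,_; proj₁; proj₂)
open import Data.Sum using (_⊎_)
open import Data.List using (List; []; _∷_; length; lookup; foldr)
open import Data.List.Relation.Unary.All using (All)
open import Data.List.Relation.Unary.AllPairs using (AllPairs)
open import Data.List.Relation.Binary.Permutation.Propositional using (_↭_)
open import Data.Vec using (Vec; zipWith; replicate)
open import Relation.Binary.Core using (Rel)
open import Relation.Binary.PropositionalEquality using (_≡_)
open import Relation.Nullary using (¬_)
open import Function.Definitions using (Injective; Surjective)
open import Algebra.Bundles using (AbelianGroup)

-- A finite subset S is represented by a duplicate-free list (w.r.t. ≈);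
-- orderings of S are lists that are permutations of that list.

module Seq {a ℓ : Level} {A : Set a} (_≈_ : Rel A ℓ) (_+_ : A → A → A) (0# : A) where

  sumL : List A → A
  sumL = foldr _+_ 0#

  partialSumsFrom : A → List A → List A
  partialSumsFrom acc []       = acc ∷ []
  partialSumsFrom acc (x ∷ xs) = acc ∷ partialSumsFrom (acc + x) xs

  partialSums : List A → List A
  partialSums = partialSumsFrom 0#

  IsFiniteSubsetNonZero : List A → Set (a ⊔ ℓ)
  IsFiniteSubsetNonZero S = AllPairs (λ x y → ¬ (x ≈ y)) S × All (λ x → ¬ (x ≈ 0#)) S

  NonZeroSum : List A → Set ℓ
  NonZeroSum S = ¬ (sumL S ≈ 0#)

  -- the partial sums of the ordering xs are pairwise distinct, except that
  -- y_k = y_0 is permitted (k = length xs)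
  DistinctPartialSums : List A → Set ℓ
  DistinctPartialSums xs =
    ∀ (i j : Fin (length (partialSums xs))) → ¬ (i ≡ j) →
      lookup (partialSums xs) i ≈ lookup (partialSums xs) j →
      (toℕ i ≡ 0 × toℕ j ≡ length xs) ⊎ (toℕ j ≡ 0 × toℕ i ≡ length xs)

  Sequenceable : List A → Set (a ⊔ ℓ)
  Sequenceable S = Data.Product.Σ (List A) (λ xs → xs ↭ S × DistinctPartialSums xs)

-- Counting elements satisfying a (not necessarily decidable) predicate:
-- CountIs P xs m  means exactly m entries of xs satisfy P.

data CountIs {a p : Level} {A : Set a} (P : A → Set p) : List A → ℕ → Set (a ⊔ p) where
  []    : CountIs P [] 0
  yes∷  : ∀ {x xs m} → P x → CountIs P xs m → CountIs P (x ∷ xs) (suc m)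
  no∷   : ∀ {x xs m} → ¬ P x → CountIs P xs m → CountIs P (x ∷ xs) m

module _ {c ℓ : Level} (H : AbelianGroup c ℓ) where
  open AbelianGroup H renaming (Carrier to ∣H∣; _≈_ to _≈H_; _∙_ to _+H_; ε to 0H)

  IsEnumeration : {t : ℕ} → (Fin (suc t) → ∣H∣) → Set (c ⊔ ℓ)
  IsEnumeration enum =
    (enum Fin.zero ≈H 0H) × Injective _≡_ _≈H_ enum × Surjective _≡_ _≈H_ enum
    where import Data.Fin as Fin

  ZH : Set c
  ZH = ℤ × ∣H∣

  _≈ZH_ : Rel ZH ℓ
  (u , g) ≈ZH (v , h) = (u ≡ v) × (g ≈H h)

  _+ZH_ : ZH → ZH → ZH
  (u , g) +ZH (v , h) = (u ℤ.+ v) , (g +H h)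

  0ZH : ZH
  0ZH = ℤ.0ℤ , 0H

  ZnH : ℕ → Set c
  ZnH n = Vec ℤ n × ∣H∣

  _≈ZnH_ : {n : ℕ} → Rel (ZnH n) ℓ
  (u , g) ≈ZnH (v , h) = (u ≡ v) × (g ≈H h)

  _+ZnH_ : {n : ℕ} → ZnH n → ZnH n → ZnH n
  (u , g) +ZnH (v , h) = zipWith ℤ._+_ u v , (g +H h)

  0ZnH : (n : ℕ) → ZnH n
  0ZnH n = replicate n ℤ.0ℤ , 0H

  HasType : {x : Level} {X : Set x} {t : ℕ} → (Fin (suc t) → ∣H∣) → List (X × ∣H∣) → (Fin (suc t) → ℕ) → Set (x ⊔ c ⊔ ℓ)
  HasType enum S lam = ∀ i → CountIs (λ s → proj₂ s ≈H enum i) S (lam i)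

{-# OPTIONS --safe #-}
-- Fix M larger than twice the total ℓ¹-size of S and consider the homomorphism
-- (v , h) ↦ (v₀ + v₁ M + … + v_{n-1} M^{n-1} , h) from ℤⁿ × H to ℤ × H.  Two vectors whose
-- ℓ¹-norms add up to less than M have the same base-M value only if they are equal, so
-- the image of S is again a non-zero sum subset of ℤ × H ∖ {0}, of the same type.  A
-- homomorphism can merge partial sums but never separate them, so every ordering of the
-- image with distinct partial sums lifts to such an ordering of S.
module Submission where

open import Defs
open import Level using (Level)
open import Data.Nat as ℕ using (ℕ; zero; suc; _≤_; _<_; s≤s)
import Data.Nat.Properties as ℕ
open import Algebra.Properties.CommutativeSemigroup ℕ.+-commutativeSemigroup
  using () renaming (interchange to +-interchange)
open import Data.Integer as ℤ using (ℤ; +_; ∣_∣; 0ℤ)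
import Data.Integer.Properties as ℤ
open import Data.Integer.Tactic.RingSolver using (solve-∀)
open import Data.Fin as Fin using (Fin; toℕ; cast)
import Data.Fin.Properties as Fin
open import Data.Vec using (Vec; []; _∷_; zipWith; replicate)
open import Data.List using (List; []; _∷_; length; lookup; map)
open import Data.List.Properties using (length-map)
open import Data.List.Relation.Unary.All as All using (All; []; _∷_)
import Data.List.Relation.Unary.All.Properties as All
open import Data.List.Relation.Unary.AllPairs as AllPairs using (AllPairs; []; _∷_)
import Data.List.Relation.Unary.AllPairs.Properties as AllPairs
open import Data.List.Relation.Binary.Permutation.Propositional using (↭-sym)
open import Data.List.Relation.Binary.Permutation.Propositional.Properties using (↭-map-inv)
open import Data.Product using (_×_; _,_; proj₁; proj₂)
open import Data.Sum using (_⊎_)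
open import Algebra.Bundles using (AbelianGroup)
open import Function using (_∘_)
open import Relation.Binary.Core using (Rel)
open import Relation.Binary.PropositionalEquality
open import Relation.Nullary using (¬_)

private variable
  a b p ℓ₁ ℓ₂ : Level
  A : Set a
  B : Set b

module _ (f : A → B) where

  cast-length-map : (xs : List A) → Fin (length xs) → Fin (length (map f xs))
  cast-length-map xs = cast (sym (length-map f xs))

  lookup-map-cast : ∀ xs i → lookup (map f xs) (cast-length-map xs i) ≡ f (lookup xs i)
  lookup-map-cast (x ∷ xs) Fin.zero    = refl
  lookup-map-cast (x ∷ xs) (Fin.suc i) = lookup-map-cast xs i

  toℕ-cast-length-map : ∀ xs i → toℕ (cast-length-map xs i) ≡ toℕ i
  toℕ-cast-length-map xs = Fin.toℕ-cast (sym (length-map f xs))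

  CountIs-map⁺ : (P : B → Set p) {xs : List A} {m : ℕ} → CountIs (P ∘ f) xs m → CountIs P (map f xs) m
  CountIs-map⁺ P []          = []
  CountIs-map⁺ P (yes∷ px c) = yes∷ px (CountIs-map⁺ P c)
  CountIs-map⁺ P (no∷ ¬px c) = no∷ ¬px (CountIs-map⁺ P c)

AllPairs-both : {P : A → Set p} {xs : List A} → All P xs → AllPairs (λ x y → P x × P y) xs
AllPairs-both []         = []
AllPairs-both (px ∷ pxs) = All.map (px ,_) pxs ∷ AllPairs-both pxs

EndPoints : ℕ → ℕ → ℕ → Set
EndPoints k i j = (i ≡ 0 × j ≡ k) ⊎ (j ≡ 0 × i ≡ k)

-- Seq.DistinctPartialSums xs unfolds to DistinctUpToEnds _≈_ (partialSums xs) (length xs).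
DistinctUpToEnds : Rel A ℓ₁ → List A → ℕ → Set _
DistinctUpToEnds _≈_ ys k = ∀ (i j : Fin (length ys)) → ¬ i ≡ j →
  lookup ys i ≈ lookup ys j → EndPoints k (toℕ i) (toℕ j)

DistinctUpToEnds-map⁻ : {_≈₁_ : Rel A ℓ₁} {_≈₂_ : Rel B ℓ₂} (f : A → B) →
  (∀ {x y} → x ≈₁ y → f x ≈₂ f y) →
  ∀ ys {k} → DistinctUpToEnds _≈₂_ (map f ys) k → DistinctUpToEnds _≈₁_ ys k
DistinctUpToEnds-map⁻ {_≈₂_ = _≈₂_} f f-cong ys {k} D i j i≢j yᵢ≈yⱼ =
  subst₂ (EndPoints k) (toℕ-cast-length-map f ys i) (toℕ-cast-length-map f ys j)
    (D (cast-length-map f ys i) (cast-length-map f ys j) (i≢j ∘ cast-length-map-injective)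
       (subst₂ _≈₂_ (sym (lookup-map-cast f ys i)) (sym (lookup-map-cast f ys j)) (f-cong yᵢ≈yⱼ)))
  where
  cast-length-map-injective : cast-length-map f ys i ≡ cast-length-map f ys j → i ≡ j
  cast-length-map-injective e = Fin.toℕ-injective (begin
    toℕ i                        ≡⟨ toℕ-cast-length-map f ys i ⟨
    toℕ (cast-length-map f ys i) ≡⟨ cong toℕ e ⟩
    toℕ (cast-length-map f ys j) ≡⟨ toℕ-cast-length-map f ys j ⟩
    toℕ j                        ∎)
    where open ≡-Reasoning

module _ {_≈₁_ : Rel A ℓ₁} {_+₁_ : A → A → A} {0₁ : A}
         {_≈₂_ : Rel B ℓ₂} {_+₂_ : B → B → B} {0₂ : B}
         (f : A → B)
         (f-+ : ∀ x y → f (x +₁ y) ≡ f x +₂ f y) (f-0 : f 0₁ ≡ 0₂)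
         (f-cong : ∀ {x y} → x ≈₁ y → f x ≈₂ f y) where

  private
    module S₁ = Seq _≈₁_ _+₁_ 0₁
    module S₂ = Seq _≈₂_ _+₂_ 0₂

  sumL-map : ∀ xs → S₂.sumL (map f xs) ≡ f (S₁.sumL xs)
  sumL-map []       = sym f-0
  sumL-map (x ∷ xs) = trans (cong (f x +₂_) (sumL-map xs)) (sym (f-+ x (S₁.sumL xs)))

  partialSumsFrom-map : ∀ acc xs → S₂.partialSumsFrom (f acc) (map f xs) ≡ map f (S₁.partialSumsFrom acc xs)
  partialSumsFrom-map acc []       = refl
  partialSumsFrom-map acc (x ∷ xs) = cong (f acc ∷_) (begin
    S₂.partialSumsFrom (f acc +₂ f x) (map f xs) ≡⟨ cong (λ z → S₂.partialSumsFrom z (map f xs)) (f-+ acc x) ⟨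
    S₂.partialSumsFrom (f (acc +₁ x)) (map f xs) ≡⟨ partialSumsFrom-map (acc +₁ x) xs ⟩
    map f (S₁.partialSumsFrom (acc +₁ x) xs)     ∎)
    where open ≡-Reasoning

  partialSums-map : ∀ xs → S₂.partialSums (map f xs) ≡ map f (S₁.partialSums xs)
  partialSums-map xs =
    trans (cong (λ z → S₂.partialSumsFrom z (map f xs)) (sym f-0)) (partialSumsFrom-map 0₁ xs)

  DistinctPartialSums-map⁻ : ∀ xs → S₂.DistinctPartialSums (map f xs) → S₁.DistinctPartialSums xs
  DistinctPartialSums-map⁻ xs D =
    DistinctUpToEnds-map⁻ {_≈₁_ = _≈₁_} {_≈₂_ = _≈₂_} f f-cong (S₁.partialSums xs)
    (subst₂ (DistinctUpToEnds _≈₂_) (partialSums-map xs) (length-map f xs) D)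

  Sequenceable-map⁻ : ∀ S → S₂.Sequenceable (map f S) → S₁.Sequenceable S
  Sequenceable-map⁻ S (xs , xs↭fS , D) with ↭-map-inv f (↭-sym xs↭fS)
  ... | ys , refl , S↭ys = ys , ↭-sym S↭ys , DistinctPartialSums-map⁻ ys D

evalAt : ∀ {n} → ℕ → Vec ℤ n → ℤ
evalAt M []      = 0ℤ
evalAt M (a ∷ v) = a ℤ.+ + M ℤ.* evalAt M v

‖_‖₁ : ∀ {n} → Vec ℤ n → ℕ
‖ [] ‖₁    = 0
‖ a ∷ v ‖₁ = ∣ a ∣ ℕ.+ ‖ v ‖₁

evalAt-zipWith-+ : ∀ {n} M (u v : Vec ℤ n) →
  evalAt M (zipWith ℤ._+_ u v) ≡ evalAt M u ℤ.+ evalAt M v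
evalAt-zipWith-+ M []      []      = refl
evalAt-zipWith-+ M (a ∷ u) (b ∷ v) rewrite evalAt-zipWith-+ M u v =
  regroup a b (+ M) (evalAt M u) (evalAt M v)
  where
  regroup : ∀ a b m x y → a ℤ.+ b ℤ.+ m ℤ.* (x ℤ.+ y) ≡ a ℤ.+ m ℤ.* x ℤ.+ (b ℤ.+ m ℤ.* y)
  regroup = solve-∀

evalAt-replicate-0 : ∀ n M → evalAt M (replicate n 0ℤ) ≡ 0ℤ
evalAt-replicate-0 zero    M = refl
evalAt-replicate-0 (suc n) M rewrite evalAt-replicate-0 n M | ℤ.*-zeroʳ (+ M) = refl

‖replicate-0‖₁ : ∀ n → ‖ replicate n 0ℤ ‖₁ ≡ 0
‖replicate-0‖₁ zero    = refl
‖replicate-0‖₁ (suc n) = ‖replicate-0‖₁ n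

‖zipWith-+‖₁≤ : ∀ {n} (u v : Vec ℤ n) → ‖ zipWith ℤ._+_ u v ‖₁ ≤ ‖ u ‖₁ ℕ.+ ‖ v ‖₁
‖zipWith-+‖₁≤ []      []      = ℕ.z≤n
‖zipWith-+‖₁≤ (a ∷ u) (b ∷ v) = begin
  ∣ a ℤ.+ b ∣ ℕ.+ ‖ zipWith ℤ._+_ u v ‖₁ ≤⟨ ℕ.+-mono-≤ (ℤ.∣i+j∣≤∣i∣+∣j∣ a b) (‖zipWith-+‖₁≤ u v) ⟩
  (∣ a ∣ ℕ.+ ∣ b ∣) ℕ.+ (‖ u ‖₁ ℕ.+ ‖ v ‖₁) ≡⟨ +-interchange ∣ a ∣ ∣ b ∣ ‖ u ‖₁ ‖ v ‖₁ ⟩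
  (∣ a ∣ ℕ.+ ‖ u ‖₁) ℕ.+ (∣ b ∣ ℕ.+ ‖ v ‖₁) ∎
  where open ℕ.≤-Reasoning

multiple-<-≡0 : ∀ M d → ∣ + M ℤ.* d ∣ < M → d ≡ 0ℤ
multiple-<-≡0 M d Md<M = ℤ.∣i∣≡0⇒i≡0 (ℕ.n<1⇒n≡0 (ℕ.*-cancelˡ-< M ∣ d ∣ 1 (begin-strict
  M ℕ.* ∣ d ∣    ≡⟨ ℤ.abs-* (+ M) d ⟨
  ∣ + M ℤ.* d ∣  <⟨ Md<M ⟩
  M              ≡⟨ ℕ.*-identityʳ M ⟨
  M ℕ.* 1        ∎)))
  where open ℕ.≤-Reasoning

-- Comparing the units digits: a - b is a multiple of M of absolute value below M.
evalAt-injective : ∀ {n} M (u v : Vec ℤ n) → ‖ u ‖₁ ℕ.+ ‖ v ‖₁ < M →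
  evalAt M u ≡ evalAt M v → u ≡ v
evalAt-injective M []      []      _     _  = refl
evalAt-injective M (a ∷ u) (b ∷ v) small eq = cong₂ _∷_ a≡b (evalAt-injective M u v tails-small u≡v)
  where
  x = evalAt M u
  y = evalAt M v
  a-b≡M[y-x] : a ℤ.- b ≡ + M ℤ.* (y ℤ.- x)
  a-b≡M[y-x] = begin
    a ℤ.- b                                                 ≡⟨ shift a b (+ M) x y ⟩
    (a ℤ.+ + M ℤ.* x) ℤ.- (b ℤ.+ + M ℤ.* y) ℤ.+ + M ℤ.* (y ℤ.- x) ≡⟨ cong (λ z → z ℤ.- (b ℤ.+ + M ℤ.* y) ℤ.+ + M ℤ.* (y ℤ.- x)) eq ⟩
    (b ℤ.+ + M ℤ.* y) ℤ.- (b ℤ.+ + M ℤ.* y) ℤ.+ + M ℤ.* (y ℤ.- x) ≡⟨ cancel (b ℤ.+ + M ℤ.* y) (+ M ℤ.* (y ℤ.- x)) ⟩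
    + M ℤ.* (y ℤ.- x)                                       ∎
    where
    open ≡-Reasoning
    shift : ∀ a b m x y → a ℤ.- b ≡ (a ℤ.+ m ℤ.* x) ℤ.- (b ℤ.+ m ℤ.* y) ℤ.+ m ℤ.* (y ℤ.- x)
    shift = solve-∀
    cancel : ∀ z w → z ℤ.- z ℤ.+ w ≡ w
    cancel = solve-∀
  digits-small : ∣ a ℤ.- b ∣ < M
  digits-small = ℕ.≤-<-trans (ℕ.≤-trans (ℤ.∣i-j∣≤∣i∣+∣j∣ a b)
    (ℕ.+-mono-≤ (ℕ.m≤m+n ∣ a ∣ ‖ u ‖₁) (ℕ.m≤m+n ∣ b ∣ ‖ v ‖₁))) small
  tails-small : ‖ u ‖₁ ℕ.+ ‖ v ‖₁ < M
  tails-small = ℕ.≤-<-trans (ℕ.+-mono-≤ (ℕ.m≤n+m ‖ u ‖₁ ∣ a ∣) (ℕ.m≤n+m ‖ v ‖₁ ∣ b ∣)) small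
  y-x≡0 : y ℤ.- x ≡ 0ℤ
  y-x≡0 = multiple-<-≡0 M (y ℤ.- x) (subst (λ z → ∣ z ∣ < M) a-b≡M[y-x] digits-small)
  a≡b : a ≡ b
  a≡b = ℤ.i-j≡0⇒i≡j a b (trans a-b≡M[y-x] (trans (cong (+ M ℤ.*_) y-x≡0) (ℤ.*-zeroʳ (+ M))))
  u≡v : x ≡ y
  u≡v = sym (ℤ.i-j≡0⇒i≡j y x y-x≡0)

module _ {c ℓ : Level} (H : AbelianGroup c ℓ) {n : ℕ} where
  private
    module ℤⁿH = Seq (_≈ZnH_ H {n}) (_+ZnH_ H) (0ZnH H n)

  totalNorm : List (ZnH H n) → ℕ
  totalNorm []       = 0
  totalNorm (s ∷ S) = ‖ proj₁ s ‖₁ ℕ.+ totalNorm S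

  All-‖‖₁≤totalNorm : ∀ S {k} → totalNorm S ≤ k → All (λ s → ‖ proj₁ s ‖₁ ≤ k) S
  All-‖‖₁≤totalNorm []      _ = []
  All-‖‖₁≤totalNorm (s ∷ S) ≤k =
    ℕ.≤-trans (ℕ.m≤m+n _ _) ≤k ∷ All-‖‖₁≤totalNorm S (ℕ.≤-trans (ℕ.m≤n+m _ _) ≤k)

  ‖sumL‖₁≤totalNorm : ∀ S → ‖ proj₁ (ℤⁿH.sumL S) ‖₁ ≤ totalNorm S
  ‖sumL‖₁≤totalNorm []      = ℕ.≤-reflexive (‖replicate-0‖₁ n)
  ‖sumL‖₁≤totalNorm (s ∷ S) = ℕ.≤-trans (‖zipWith-+‖₁≤ (proj₁ s) (proj₁ (ℤⁿH.sumL S)))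
    (ℕ.+-monoʳ-≤ ‖ proj₁ s ‖₁ (‖sumL‖₁≤totalNorm S))

module BaseEncoding {c ℓ : Level} (H : AbelianGroup c ℓ) (n r : ℕ) where
  open AbelianGroup H using () renaming (_≈_ to _≈H_)
  private
    module ℤⁿH = Seq (_≈ZnH_ H {n}) (_+ZnH_ H) (0ZnH H n)
    module ℤH = Seq (_≈ZH_ H) (_+ZH_ H) (0ZH H)

  M : ℕ
  M = suc (r ℕ.+ r)

  Small : ZnH H n → Set
  Small s = ‖ proj₁ s ‖₁ ≤ r

  encode : ZnH H n → ZH H
  encode (v , h) = evalAt M v , h

  encode-+ : ∀ x y → encode (_+ZnH_ H x y) ≡ _+ZH_ H (encode x) (encode y)
  encode-+ (u , _) (v , _) = cong (_, _) (evalAt-zipWith-+ M u v)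

  encode-0 : encode (0ZnH H n) ≡ 0ZH H
  encode-0 = cong (_, _) (evalAt-replicate-0 n M)

  encode-cong : ∀ {x y} → _≈ZnH_ H x y → _≈ZH_ H (encode x) (encode y)
  encode-cong (u≡v , g≈h) = cong (evalAt M) u≡v , g≈h

  encode-reflects-≈ : ∀ {x y} → Small x → Small y → _≈ZH_ H (encode x) (encode y) → _≈ZnH_ H x y
  encode-reflects-≈ {u , _} {v , _} u-small v-small (eq , g≈h) =
    evalAt-injective M u v (s≤s (ℕ.+-mono-≤ u-small v-small)) eq , g≈h

  encode-reflects-0 : ∀ {x} → Small x → _≈ZH_ H (encode x) (0ZH H) → _≈ZnH_ H x (0ZnH H n)
  encode-reflects-0 x-small =
    encode-reflects-≈ x-small (ℕ.≤-trans (ℕ.≤-reflexive (‖replicate-0‖₁ n)) ℕ.z≤n)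
    ∘ subst (_≈ZH_ H _) (sym encode-0)

  IsFiniteSubsetNonZero-encode : ∀ {S} → All Small S →
    ℤⁿH.IsFiniteSubsetNonZero S → ℤH.IsFiniteSubsetNonZero (map encode S)
  IsFiniteSubsetNonZero-encode small (distinct , nonzero) =
    AllPairs.map⁺ (AllPairs.zipWith (λ ((x-small , y-small) , x≉y) → x≉y ∘ encode-reflects-≈ x-small y-small)
                                    (AllPairs-both small , distinct)) ,
    All.map⁺ (All.zipWith (λ (x-small , x≉0) → x≉0 ∘ encode-reflects-0 x-small) (small , nonzero))

  NonZeroSum-encode : ∀ {S} → Small (ℤⁿH.sumL S) → ℤⁿH.NonZeroSum S → ℤH.NonZeroSum (map encode S)
  NonZeroSum-encode {S} sum-small ΣS≉0 =
    ΣS≉0 ∘ encode-reflects-0 sum-small ∘ subst (λ z → _≈ZH_ H z (0ZH H)) (sumL-map {_≈₁_ = _≈ZnH_ H} {_≈₂_ = _≈ZH_ H} encode encode-+ encode-0 encode-cong S)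

  HasType-encode : ∀ {t} {enum : Fin (suc t) → AbelianGroup.Carrier H} {S lam} →
    HasType H enum S lam → HasType H enum (map encode S) lam
  HasType-encode {enum = enum} type i = CountIs-map⁺ encode (λ s → proj₂ s ≈H enum i) (type i)

  Sequenceable-encode⁻ : ∀ S → ℤH.Sequenceable (map encode S) → ℤⁿH.Sequenceable S
  Sequenceable-encode⁻ = Sequenceable-map⁻ {_≈₁_ = _≈ZnH_ H} {_≈₂_ = _≈ZH_ H} encode encode-+ encode-0 encode-cong

proposition4p3 : ∀ {c ℓ : Level} (H : AbelianGroup c ℓ) (t : ℕ)
    (enum : Fin (suc t) → AbelianGroup.Carrier H) → IsEnumeration H enum →
    (lam : Fin (suc t) → ℕ) →
    (∀ (S : List (ZH H)) →
      Seq.IsFiniteSubsetNonZero (_≈ZH_ H) (_+ZH_ H) (0ZH H) S →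
      Seq.NonZeroSum (_≈ZH_ H) (_+ZH_ H) (0ZH H) S →
      HasType H enum S lam →
      Seq.Sequenceable (_≈ZH_ H) (_+ZH_ H) (0ZH H) S) →
    ∀ (n : ℕ) → 2 ≤ n →
    ∀ (S : List (ZnH H n)) →
      Seq.IsFiniteSubsetNonZero (_≈ZnH_ H) (_+ZnH_ H) (0ZnH H n) S →
      Seq.NonZeroSum (_≈ZnH_ H) (_+ZnH_ H) (0ZnH H n) S →
      HasType H enum S lam →
      Seq.Sequenceable (_≈ZnH_ H) (_+ZnH_ H) (0ZnH H n) S
proposition4p3 H t enum _ lam sequenceable-ℤ×H n _ S subset nonZeroSum type =
  Sequenceable-encode⁻ S (sequenceable-ℤ×H (map encode S)
    (IsFiniteSubsetNonZero-encode (All-‖‖₁≤totalNorm H S ℕ.≤-refl) subset)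
    (NonZeroSum-encode {S} (‖sumL‖₁≤totalNorm H S) nonZeroSum)
    (HasType-encode type))
  where open BaseEncoding H n (totalNorm H S)
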